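{- For every hypersequent $G$: if $G$ is derivable in the hypersequent calculus $\mathbf{HR}$, then $[\![G]\!]\geq 0$ is derivable in equational logic from the axioms of Riesz spaces, i.e. the inequality $[\![G]\!]\geq 0$ holds in every Riesz space under every assignment of the variables.
   Context: Terms. Fix a countable set of variables $x,y,z,\dots$. Terms (in negation normal form) are generated by $A ::= x \mid \overline{x} \mid 0 \mid A+A \mid rA \mid A\sqcup A \mid A\sqcap A$, where $x$ is a variable, $\overline{x}$ is the corresponding negated variable, and $r\in\mathbb{R}_{>0}$. The negation $\overline{A}$ of a term is defined by $\overline{x}$ (for $x$), $\overline{\overline{x}}=x$, $\overline{0}=0$, $\overline{A+B}=\overline{A}+\overline{B}$, $\overline{rA}=r\overline{A}$, $\overline{A\sqcup B}=\overline{A}\sqcap\overline{B}$, $\overline{A\sqcap B}=\overline{A}\sqcup\overline{B}$. Terms are interpreted in Riesz spaces (vector lattices) reading $\overline{x}$ as $-x$, $rA$ as scalar multiplication, and $\sqcup,\sqcap$ as join and meet. A weighted term is $r.A$ with $r\in\mathbb{R}_{>0}$; a sequent $\vdash\Gamma$ has $\Gamma$ a finite (possibly empty) multiset of weighted terms; a hypersequent is a nonempty finite multiset of sequents, written $\vdash\Gamma_1\mid\cdots\mid\vdash\Gamma_n$, and $G\mid\vdash\Gamma$ denotes the hypersequent $G$ with the sequent $\vdash\Gamma$ added. For a finite (possibly empty) sequence $\vec r=(r_1,\dots,r_n)$ of strictly positive reals, $\vec r.A$ is the multiset $r_1.A,\dots,r_n.A$, $\sum\vec r=r_1+\dots+r_n$,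 and $s\vec r=(sr_1,\dots,sr_n)$; for $s>0$, $s.\Gamma$ multiplies every weight in $\Gamma$ by $s$. Interpretation: $[\![r.A]\!]=rA$; $[\![\vdash r_1.A_1,\dots,r_n.A_n]\!]=r_1A_1+\dots+r_nA_n$ (empty sum $=0$); $[\![\vdash\Gamma_1\mid\dots\mid\vdash\Gamma_n]\!]=[\![\vdash\Gamma_1]\!]\sqcup\dots\sqcup[\![\vdash\Gamma_n]\!]$. The calculus $\mathbf{HR}$ has the rules (vectors are finite sequences of strictly positive reals): INIT: the hypersequent $\vdash$ (one empty sequent) with no premises. W: from $G$ infer $G\mid\vdash\Gamma$. C: from $G\mid\vdash\Gamma\mid\vdash\Gamma$ infer $G\mid\vdash\Gamma$. S: from $G\mid\vdash\Gamma_1,\Gamma_2$ infer $G\mid\vdash\Gamma_1\mid\vdash\Gamma_2$. M: from $G\mid\vdash\Gamma_1$ and $G\mid\vdash\Gamma_2$ infer $G\mid\vdash\Gamma_1,\Gamma_2$. T: for $r>0$, from $G\mid\vdash r.\Gamma$ infer $G\mid\vdash\Gamma$. ID: if $\sum\vec r=\sum\vec s$, from $G\mid\vdash\Gamma$ infer $G\mid\vdash\Gamma,\vec r.x,\vec s.\overline{x}$ ($x$ a variable). 0: from $G\mid\vdash\Gamma$ infer $G\mid\vdash\Gamma,\vec r.0$. $+$: from $G\mid\vdash\Gamma,\vec r.A,\vec r.B$ infer $G\mid\vdash\Gamma,\vec r.(A+B)$. $\times$: from $G\mid\vdash\Gamma,(s\vec r).A$ infer $G\mid\vdash\Gamma,\vec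 r.(sA)$. $\sqcup$: from $G\mid\vdash\Gamma,\vec r.A\mid\vdash\Gamma,\vec r.B$ infer $G\mid\vdash\Gamma,\vec r.(A\sqcup B)$. $\sqcap$: from $G\mid\vdash\Gamma,\vec r.A$ and $G\mid\vdash\Gamma,\vec r.B$ infer $G\mid\vdash\Gamma,\vec r.(A\sqcap B)$. CAN: if $\sum\vec r=\sum\vec s$, from $G\mid\vdash\Gamma,\vec s.A,\vec r.\overline{A}$ infer $G\mid\vdash\Gamma$. A derivation is a finite tree of rule instances whose leaves are INIT. -}

module Defs where

open import Data.Nat using (ℕ)
open import Data.Product using (Σ; ∃; _×_; _,_; proj₁; proj₂)
open import Data.Sum using (_⊎_)
open import Data.List using (List; []; _∷_; _++_; map; foldr)
open import Data.List.Relation.Binary.Permutation.Propositional using (_↭_)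
open import Relation.Binary.PropositionalEquality using (_≡_)
open import Relation.Nullary using (¬_)
import Algebra.Structures as AS
import Algebra.Lattice.Structures as LS

-- The real numbers, axiomatised as a Dedekind-complete ordered field
-- (every such structure is isomorphic to ℝ).

record RealField : Set₁ where
  infixl 7 _*_
  infixl 6 _+_
  infix 4 _<_ _≤_
  field
    Carrier : Set
    _+_ _*_ : Carrier → Carrier → Carrier
    -_      : Carrier → Carrier
    0# 1#   : Carrier
    isCommutativeRing : AS.IsCommutativeRing (_≡_ {A = Carrier}) _+_ _*_ -_ 0# 1#
    0≢1     : ¬ (0# ≡ 1#)
    _⁻¹     : (x : Carrier) → ¬ (x ≡ 0#) → Carrier
    ⁻¹-inverse : (x : Carrier) (p : ¬ (x ≡ 0#)) → x * (_⁻¹ x p) ≡ 1#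
    _<_     : Carrier → Carrier → Set
    <-irrefl : ∀ x → ¬ (x < x)
    <-trans  : ∀ {x y z} → x < y → y < z → x < z
    <-trichotomy : ∀ x y → x < y ⊎ (x ≡ y ⊎ y < x)
    +-mono-< : ∀ {x y} z → x < y → x + z < y + z
    *-pos    : ∀ {x y} → 0# < x → 0# < y → 0# < x * y
  _≤_ : Carrier → Carrier → Set
  x ≤ y = x < y ⊎ x ≡ y
  field
    complete : (P : Carrier → Set) → ∃ P → (∃ λ b → ∀ x → P x → x ≤ b) →
               ∃ λ s → (∀ x → P x → x ≤ s) × (∀ b → (∀ x → P x → x ≤ b) → s ≤ b)

record RieszSpace (F : RealField) : Set₁ where
  open RealField F using () renaming (Carrier to ℝ; _*_ to _*ℝ_; _+_ to _+ℝ_; 1# to 1ℝ; _≤_ to _≤ℝ_; 0# to 0ℝ)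
  infixl 6 _+_
  infixr 7 _·_
  infix 4 _≤_
  field
    Carrier : Set
    _+_     : Carrier → Carrier → Carrier
    -_      : Carrier → Carrier
    0#      : Carrier
    _·_     : ℝ → Carrier → Carrier
    _⊔_ _⊓_ : Carrier → Carrier → Carrier
    isAbelianGroup : AS.IsAbelianGroup (_≡_ {A = Carrier}) _+_ 0# -_
    ·-assoc   : ∀ r s x → (r *ℝ s) · x ≡ r · (s · x)
    ·-identity : ∀ x → 1ℝ · x ≡ x
    ·-distribˡ : ∀ r x y → r · (x + y) ≡ r · x + r · y
    ·-distribʳ : ∀ r s x → (r +ℝ s) · x ≡ r · x + s · x
    isLattice : LS.IsLattice (_≡_ {A = Carrier}) _⊔_ _⊓_
  _≤_ : Carrier → Carrier → Set
  x ≤ y = x ⊓ y ≡ x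
  field
    +-compat : ∀ x y z → (x ⊓ y) + z ≤ y + z
    ·-compat : ∀ r x y → 0ℝ ≤ℝ r → r · (x ⊓ y) ≤ r · y

module Syntax (F : RealField) where
  open RealField F using (_<_; _*_; *-pos) renaming (Carrier to ℝ; _+_ to _+ℝ_; 0# to 0ℝ)

  ℝ⁺ : Set
  ℝ⁺ = Σ ℝ (λ r → 0ℝ < r)

  _*⁺_ : ℝ⁺ → ℝ⁺ → ℝ⁺
  (r , p) *⁺ (s , q) = (r * s , *-pos p q)

  -- terms in negation normal form; variables are indexed by ℕ
  data Term : Set where
    var  : ℕ → Term
    nvar : ℕ → Term
    zero : Term
    _⊕_  : Term → Term → Term
    _⊛_  : ℝ⁺ → Term → Term
    _⊔ₜ_ : Term → Term → Term
    _⊓ₜ_ : Term → Term → Term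

  neg : Term → Term
  neg (var x)  = nvar x
  neg (nvar x) = var x
  neg zero     = zero
  neg (A ⊕ B)  = neg A ⊕ neg B
  neg (r ⊛ A)  = r ⊛ neg A
  neg (A ⊔ₜ B) = neg A ⊓ₜ neg B
  neg (A ⊓ₜ B) = neg A ⊔ₜ neg B

  WTerm : Set
  WTerm = ℝ⁺ × Term

  -- sequents (multisets as lists, up to permutation via exchange rules)
  Sequent : Set
  Sequent = List WTerm

  _∙ₗ_ : List ℝ⁺ → Term → Sequent
  rs ∙ₗ A = map (λ r → (r , A)) rs

  Σ⁺ : List ℝ⁺ → ℝ
  Σ⁺ = foldr (λ r acc → proj₁ r +ℝ acc) 0ℝ

  scaleV : ℝ⁺ → List ℝ⁺ → List ℝ⁺
  scaleV s = map (s *⁺_)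

  scaleS : ℝ⁺ → Sequent → Sequent
  scaleS s = map (λ { (r , A) → (s *⁺ r , A) })

  -- HR : a hypersequent is a nonempty list of sequents; G here is a List Sequent,
  -- and a derivable hypersequent is always nonempty.  "G | ⊢ Γ" is written Γ ∷ G.
  data HR : List Sequent → Set where
    INIT  : HR ([] ∷ [])
    ex-H  : ∀ {G H} → G ↭ H → HR G → HR H
    ex-S  : ∀ {G Γ Δ} → Γ ↭ Δ → HR (Γ ∷ G) → HR (Δ ∷ G)
    W     : ∀ {G Γ} → HR G → HR (Γ ∷ G)
    C     : ∀ {G Γ} → HR (Γ ∷ Γ ∷ G) → HR (Γ ∷ G)
    S     : ∀ {G Γ₁ Γ₂} → HR ((Γ₁ ++ Γ₂) ∷ G) → HR (Γ₁ ∷ Γ₂ ∷ G)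
    M     : ∀ {G Γ₁ Γ₂} → HR (Γ₁ ∷ G) → HR (Γ₂ ∷ G) → HR ((Γ₁ ++ Γ₂) ∷ G)
    T     : ∀ {G Γ} (r : ℝ⁺) → HR (scaleS r Γ ∷ G) → HR (Γ ∷ G)
    ID    : ∀ {G Γ} (rs ss : List ℝ⁺) (x : ℕ) → Σ⁺ rs ≡ Σ⁺ ss →
            HR (Γ ∷ G) → HR ((Γ ++ (rs ∙ₗ var x) ++ (ss ∙ₗ nvar x)) ∷ G)
    Z     : ∀ {G Γ} (rs : List ℝ⁺) → HR (Γ ∷ G) → HR ((Γ ++ (rs ∙ₗ zero)) ∷ G)
    PLUS  : ∀ {G Γ} (rs : List ℝ⁺) (A B : Term) →
            HR ((Γ ++ (rs ∙ₗ A) ++ (rs ∙ₗ B)) ∷ G) → HR ((Γ ++ (rs ∙ₗ (A ⊕ B))) ∷ G)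
    TIMES : ∀ {G Γ} (rs : List ℝ⁺) (s : ℝ⁺) (A : Term) →
            HR ((Γ ++ (scaleV s rs ∙ₗ A)) ∷ G) → HR ((Γ ++ (rs ∙ₗ (s ⊛ A))) ∷ G)
    JOIN  : ∀ {G Γ} (rs : List ℝ⁺) (A B : Term) →
            HR ((Γ ++ (rs ∙ₗ A)) ∷ (Γ ++ (rs ∙ₗ B)) ∷ G) → HR ((Γ ++ (rs ∙ₗ (A ⊔ₜ B))) ∷ G)
    MEET  : ∀ {G Γ} (rs : List ℝ⁺) (A B : Term) →
            HR ((Γ ++ (rs ∙ₗ A)) ∷ G) → HR ((Γ ++ (rs ∙ₗ B)) ∷ G) →
            HR ((Γ ++ (rs ∙ₗ (A ⊓ₜ B))) ∷ G)
    CAN   : ∀ {G Γ} (rs ss : List ℝ⁺) (A : Term) → Σ⁺ rs ≡ Σ⁺ ss →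
            HR ((Γ ++ (ss ∙ₗ A) ++ (rs ∙ₗ neg A)) ∷ G) → HR (Γ ∷ G)

  module Interp (V : RieszSpace F) (ρ : ℕ → RieszSpace.Carrier V) where
    open RieszSpace V

    ⟦_⟧ₜ : Term → Carrier
    ⟦ var x ⟧ₜ  = ρ x
    ⟦ nvar x ⟧ₜ = - ρ x
    ⟦ zero ⟧ₜ   = 0#
    ⟦ A ⊕ B ⟧ₜ  = ⟦ A ⟧ₜ + ⟦ B ⟧ₜ
    ⟦ r ⊛ A ⟧ₜ  = proj₁ r · ⟦ A ⟧ₜ
    ⟦ A ⊔ₜ B ⟧ₜ = ⟦ A ⟧ₜ ⊔ ⟦ B ⟧ₜ
    ⟦ A ⊓ₜ B ⟧ₜ = ⟦ A ⟧ₜ ⊓ ⟦ B ⟧ₜ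

    ⟦_⟧ₛ : Sequent → Carrier
    ⟦ [] ⟧ₛ          = 0#
    ⟦ (r , A) ∷ Γ ⟧ₛ = proj₁ r · ⟦ A ⟧ₜ + ⟦ Γ ⟧ₛ

    ⟦_∣_⟧ₕ : Sequent → List Sequent → Carrier
    ⟦ Γ ∣ [] ⟧ₕ    = ⟦ Γ ⟧ₛ
    ⟦ Γ ∣ Δ ∷ G ⟧ₕ = ⟦ Γ ⟧ₛ ⊔ ⟦ Δ ∣ G ⟧ₕ

module Submission where

-- Rules acting inside one sequent preserve its value
-- (linearity of the interpretation; translations and positive scalings are
-- order automorphisms, so they commute with ⊔ and ⊓).  The rules M, T and S
-- must be checked in an arbitrary context g.  With x⁻ = (−x) ⊔ 0 one has
-- 0 ≤ x ⊔ g iff x⁻ ⊓ g⁻ ≤ 0, i.e. iff x⁻ and g⁻ are disjoint; disjointness from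
-- g⁻ survives sums, because (x + y)⁻ ≤ x⁻ + y⁻ and (p + q) ⊓ w ≤ p ⊓ w + q ⊓ w
-- for positive p, q, w, and survives positive rescaling.  S reduces to T with
-- r = 2, since x + y ≤ 2 ((x ⊔ y) ⊔ g).

open import Defs
open import Data.Nat using (ℕ)
open import Data.List using (List; []; _∷_; _++_; foldr)
open import Data.List.Relation.Binary.Permutation.Propositional using (_↭_; refl; prep; swap; trans)
open import Data.List.Relation.Binary.Permutation.Propositional.Properties using (¬x∷xs↭[])
open import Data.Product using (_,_; proj₁; proj₂)
open import Data.Sum using (_⊎_; inj₁; inj₂)
open import Data.Empty using (⊥; ⊥-elim)
open import Level using (Level; 0ℓ) renaming (_⊔_ to _⊔ˡ_)
open import Relation.Nullary using (¬_)
open import Relation.Binary.PropositionalEquality as ≡ using (_≡_; cong; cong₂; subst; subst₂; sym)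
open import Algebra.Bundles using (CommutativeRing; AbelianGroup; CommutativeSemigroup)
open import Algebra.Lattice.Bundles using (Semilattice) renaming (Lattice to AlgebraicLattice)
open import Algebra.Structures using (IsCommutativeBand)
import Algebra.Properties.CommutativeSemigroup as CommutativeSemigroupProperties
open import Relation.Binary.Lattice using (Lattice; IsLattice)
open import Relation.Binary.Lattice.Definitions using (Supremum)
open import Relation.Binary.Core using (Rel)
import Algebra.Lattice.Properties.Lattice as AlgebraicLatticeProperties
import Algebra.Properties.AbelianGroup as AbelianGroupProperties
import Relation.Binary.Lattice.Properties.JoinSemilattice as JoinSemilatticeProperties
import Relation.Binary.Lattice.Properties.MeetSemilattice as MeetSemilatticeProperties
import Algebra.Properties.Ring as RingProperties
import Relation.Binary.Lattice.Properties.Lattice as LatticeProperties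
import Relation.Binary.Reasoning.PartialOrder as ≤-Reasoning

private variable c₁ ℓ₁ ℓ₂ c₂ ℓ₃ ℓ₄ : Level

record OrderIsomorphism (L₁ : Lattice c₁ ℓ₁ ℓ₂) (L₂ : Lattice c₂ ℓ₃ ℓ₄)
       : Set (c₁ ⊔ˡ ℓ₁ ⊔ˡ ℓ₂ ⊔ˡ c₂ ⊔ˡ ℓ₃ ⊔ˡ ℓ₄) where
  open Lattice L₁ using () renaming (Carrier to A; _≈_ to _≈₁_; _≤_ to _≤₁_)
  open Lattice L₂ using () renaming (Carrier to B; _≈_ to _≈₂_; _≤_ to _≤₂_)
  field
    to        : A → B
    from      : B → A
    to-mono   : ∀ {x y} → x ≤₁ y → to x ≤₂ to y
    from-mono : ∀ {x y} → x ≤₂ y → from x ≤₁ from y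
    to∘from   : ∀ y → to (from y) ≈₂ y
    from∘to   : ∀ x → from (to x) ≈₁ x

module _ {L₁ : Lattice c₁ ℓ₁ ℓ₂} {L₂ : Lattice c₂ ℓ₃ ℓ₄} where

  open LatticeProperties using (∧-∨-lattice)

  dual : OrderIsomorphism L₁ L₂ → OrderIsomorphism (∧-∨-lattice L₁) (∧-∨-lattice L₂)
  dual φ = record { OrderIsomorphism φ }

module _ {L₁ : Lattice c₁ ℓ₁ ℓ₂} {L₂ : Lattice c₂ ℓ₃ ℓ₄}
         (φ : OrderIsomorphism L₁ L₂) where

  open OrderIsomorphism φ
  open Lattice L₁ using () renaming
    (_≤_ to _≤₁_; _∧_ to _∧₁_; x∧y≤x to x∧y≤₁x; x∧y≤y to x∧y≤₁y; ∧-greatest to ∧₁-greatest; ≤-respʳ-≈ to ≤₁-respʳ-≈₁)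
  open Lattice L₂ using (_≈_; _≤_; _∧_; x∧y≤x; x∧y≤y; ∧-greatest; antisym)
  open ≤-Reasoning (Lattice.poset L₂)

  to-∧ : ∀ x y → to (x ∧₁ y) ≈ to x ∧ to y
  to-∧ x y = antisym (∧-greatest (to-mono (x∧y≤₁x x y)) (to-mono (x∧y≤₁y x y))) (begin
    to x ∧ to y             ≈⟨ to∘from _ ⟨
    to (from (to x ∧ to y)) ≤⟨ to-mono (∧₁-greatest (from-below x (x∧y≤x _ _)) (from-below y (x∧y≤y _ _))) ⟩
    to (x ∧₁ y)             ∎)
    where
    from-below : ∀ x {z} → z ≤ to x → from z ≤₁ x
    from-below x z≤tox = ≤₁-respʳ-≈₁ (from∘to x) (from-mono z≤tox)

module _ {L₁ : Lattice c₁ ℓ₁ ℓ₂} {L₂ : Lattice c₂ ℓ₃ ℓ₄} (φ : OrderIsomorphism L₁ L₂) where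

  open OrderIsomorphism φ
  open Lattice L₁ using () renaming (_∨_ to _∨₁_)
  open Lattice L₂ using (_≈_; _∨_)

  to-∨ : ∀ x y → to (x ∨₁ y) ≈ to x ∨ to y
  to-∨ = to-∧ (dual φ)

module _ {c ℓ} (S : CommutativeSemigroup c ℓ) where

  open CommutativeSemigroup S renaming (refl to ≈-refl; trans to ≈-trans)
  open CommutativeSemigroupProperties S using (x∙yz≈y∙xz)

  foldr-↭ : ∀ {a} {A : Set a} (f : A → Carrier) e {xs ys} → xs ↭ ys →
            foldr (λ x → f x ∙_) e xs ≈ foldr (λ x → f x ∙_) e ys
  foldr-↭ f e refl         = ≈-refl
  foldr-↭ f e (prep x p)   = ∙-congˡ (foldr-↭ f e p)
  foldr-↭ f e (swap x y p) = ≈-trans (x∙yz≈y∙xz (f x) (f y) _) (∙-congˡ (∙-congˡ (foldr-↭ f e p)))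
  foldr-↭ f e (trans p q)  = ≈-trans (foldr-↭ f e p) (foldr-↭ f e q)

module OrderedFieldProperties (F : RealField) where

  open RealField F

  commutativeRing : CommutativeRing 0ℓ 0ℓ
  commutativeRing = record { isCommutativeRing = isCommutativeRing }

  open CommutativeRing commutativeRing public
    using (+-assoc; +-identityˡ; +-identityʳ; -‿inverseʳ; *-identityˡ; *-comm; zeroʳ)
  open RingProperties (CommutativeRing.ring commutativeRing) public
    using (-‿distribˡ-*; -‿distribʳ-*; -‿involutive; xyx⁻¹≈y)

  x<y⇒0<y-x : ∀ {x y} → x < y → 0# < y + - x
  x<y⇒0<y-x {x} {y} x<y = subst (_< y + - x) (-‿inverseʳ x) (+-mono-< (- x) x<y)

  +-pos : ∀ {x y} → 0# < x → 0# ≤ y → 0# < x + y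
  +-pos {x} {y} 0<x (inj₁ 0<y) = <-trans 0<y (subst (_< x + y) (+-identityˡ y) (+-mono-< y 0<x))
  +-pos {x} 0<x (inj₂ ≡.refl) = subst (0# <_) (sym (+-identityʳ x)) 0<x

  0<x⇒0≮-x : ∀ {x} → 0# < x → ¬ (0# < - x)
  0<x⇒0≮-x {x} 0<x 0<-x = <-irrefl 0# (subst (0# <_) (-‿inverseʳ x) (+-pos 0<x (inj₁ 0<-x)))

  0<1 : 0# < 1#
  0<1 with <-trichotomy 0# 1#
  ... | inj₁ 0<1 = 0<1
  ... | inj₂ (inj₁ 0≡1) = ⊥-elim (0≢1 0≡1)
  ... | inj₂ (inj₂ 1<0) = ⊥-elim (0<x⇒0≮-x (subst (0# <_) [-1][-1]≡1 (*-pos 0<-1 0<-1)) 0<-1)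
    where
    0<-1 : 0# < - 1#
    0<-1 = subst (0# <_) (+-identityˡ (- 1#)) (x<y⇒0<y-x 1<0)
    [-1][-1]≡1 : - 1# * - 1# ≡ 1#
    [-1][-1]≡1 = ≡.trans (sym (-‿distribˡ-* 1# (- 1#))) (≡.trans (cong -_ (*-identityˡ (- 1#))) (-‿involutive 1#))

  x+[y-x]≡y : ∀ x y → x + (y + - x) ≡ y
  x+[y-x]≡y x y = ≡.trans (sym (+-assoc x y (- x))) (xyx⁻¹≈y x y)

  0<⇒≢0 : ∀ {x} → 0# < x → ¬ (x ≡ 0#)
  0<⇒≢0 {x} 0<x x≡0 = <-irrefl 0# (subst (0# <_) x≡0 0<x)

  ⁻¹-pos : ∀ {x} (0<x : 0# < x) → 0# < (x ⁻¹) (0<⇒≢0 0<x)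
  ⁻¹-pos {x} 0<x with <-trichotomy 0# ((x ⁻¹) (0<⇒≢0 0<x))
  ... | inj₁ 0<x⁻¹ = 0<x⁻¹
  ... | inj₂ (inj₁ 0≡x⁻¹) = ⊥-elim (0≢1 (≡.trans (sym (zeroʳ x)) (≡.trans (cong (x *_) 0≡x⁻¹) (⁻¹-inverse x _))))
  ... | inj₂ (inj₂ x⁻¹<0) = ⊥-elim (0<x⇒0≮-x 0<1 (subst (0# <_) x[-x⁻¹]≡-1 (*-pos 0<x 0<-x⁻¹)))
    where
    x⁻¹ : Carrier
    x⁻¹ = (x ⁻¹) (0<⇒≢0 0<x)
    0<-x⁻¹ : 0# < - x⁻¹
    0<-x⁻¹ = subst (0# <_) (+-identityˡ _) (x<y⇒0<y-x x⁻¹<0)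
    x[-x⁻¹]≡-1 : x * - x⁻¹ ≡ - 1#
    x[-x⁻¹]≡-1 = ≡.trans (sym (-‿distribʳ-* x _)) (cong -_ (⁻¹-inverse x _))

  ≤-total : ∀ x y → x ≤ y ⊎ y ≤ x
  ≤-total x y with <-trichotomy x y
  ... | inj₁ x<y = inj₁ (inj₁ x<y)
  ... | inj₂ (inj₁ x≡y) = inj₁ (inj₂ x≡y)
  ... | inj₂ (inj₂ y<x) = inj₂ (inj₁ y<x)

module RieszSpaceProperties (F : RealField) (V : RieszSpace F) where

  open RealField F using () renaming
    ( Carrier to ℝ; _+_ to _+ℝ_; _*_ to _*ℝ_; -_ to -ℝ_; 0# to 0ℝ; 1# to 1ℝ
    ; _<_ to _<ℝ_; _≤_ to _≤ℝ_; _⁻¹ to _⁻¹ℝ; ⁻¹-inverse to ⁻¹-inverse)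
  private module ℝ = OrderedFieldProperties F
  open RieszSpace V

  algebraicLattice : AlgebraicLattice 0ℓ 0ℓ
  algebraicLattice = record { isLattice = isLattice }

  private
    module A = AlgebraicLatticeProperties algebraicLattice
    module O = IsLattice A.∨-∧-isOrderTheoreticLattice

    -- The natural order of Algebra.Lattice reads x ≤ y as x ≡ x ⊓ y.
    supremum : ∀ {R S : Rel Carrier 0ℓ} {op} → (∀ {x y} → R x y → S x y) → (∀ {x y} → S x y → R x y) →
               Supremum R op → Supremum S op
    supremum R⇒S S⇒R sup x y with sup x y
    ... | x≤xy , y≤xy , least = R⇒S x≤xy , R⇒S y≤xy , λ z x≤z y≤z → R⇒S (least z (S⇒R x≤z) (S⇒R y≤z))

  order : Lattice _ _ _
  order = record
    { isLattice = record
      { isPartialOrder = record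
        { isPreorder = record
          { isEquivalence = ≡.isEquivalence
          ; reflexive = λ x≡y → sym (O.reflexive x≡y)
          ; trans = λ x≤y y≤z → sym (O.trans (sym x≤y) (sym y≤z))
          }
        ; antisym = λ x≤y y≤x → O.antisym (sym x≤y) (sym y≤x)
        }
      ; supremum = supremum sym sym O.supremum
      ; infimum = supremum sym sym O.infimum
      }
    }

  open Lattice order public using (x≤x∨y; y≤x∨y; ∨-least; x∧y≤x; x∧y≤y; ∧-greatest)
    renaming (refl to ≤-refl; reflexive to ≤-reflexive; trans to ≤-trans; antisym to ≤-antisym)
  open JoinSemilatticeProperties (Lattice.joinSemilattice order) public
    using (∨-monotonic; ∨-idempotent; ∨-comm; ∨-assoc)
  open MeetSemilatticeProperties (Lattice.meetSemilattice order) public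
    using (∧-monotonic; ∧-idempotent)

  +-abelianGroup : AbelianGroup 0ℓ 0ℓ
  +-abelianGroup = record { isAbelianGroup = isAbelianGroup }

  +-commutativeSemigroup : CommutativeSemigroup 0ℓ 0ℓ
  +-commutativeSemigroup = AbelianGroup.commutativeSemigroup +-abelianGroup

  ⊔-commutativeSemigroup : CommutativeSemigroup 0ℓ 0ℓ
  ⊔-commutativeSemigroup = record
    { isCommutativeSemigroup = IsCommutativeBand.isCommutativeSemigroup (Semilattice.isSemilattice A.∨-semilattice) }

  open AbelianGroup +-abelianGroup public using (assoc; comm; identityˡ; identityʳ; inverseʳ)
  open AbelianGroupProperties +-abelianGroup public
    using (inverseʳ-unique; identityˡ-unique; \\-leftDividesˡ; \\-leftDividesʳ; //-rightDividesʳ)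
    renaming (⁻¹-involutive to -‿involutive; ε⁻¹≈ε to -0#≡0#; ⁻¹-∙-comm to -‿+-comm)

  +-monoˡ-≤ : ∀ z {x y} → x ≤ y → x + z ≤ y + z
  +-monoˡ-≤ z {x} {y} x≤y = subst (λ w → w + z ≤ y + z) x≤y (+-compat x y z)

  +-monoʳ-≤ : ∀ z {x y} → x ≤ y → z + x ≤ z + y
  +-monoʳ-≤ z {x} {y} x≤y = subst₂ _≤_ (comm x z) (comm y z) (+-monoˡ-≤ z x≤y)

  +-mono-≤ : ∀ {x y u v} → x ≤ y → u ≤ v → x + u ≤ y + v
  +-mono-≤ {y = y} {u} x≤y u≤v = ≤-trans (+-monoˡ-≤ u x≤y) (+-monoʳ-≤ y u≤v)

  -‿antitone : ∀ {x y} → x ≤ y → - y ≤ - x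
  -‿antitone {x} {y} x≤y = subst₂ _≤_ (\\-leftDividesˡ x (- y)) y+[-x-y]≡-x (+-monoˡ-≤ (- x + - y) x≤y)
    where
    y+[-x-y]≡-x : y + (- x + - y) ≡ - x
    y+[-x-y]≡-x = ≡.trans (cong (y +_) (comm (- x) (- y))) (\\-leftDividesˡ y (- x))

  +-iso : Carrier → OrderIsomorphism order order
  +-iso z = record
    { to = z +_ ; from = - z +_ ; to-mono = +-monoʳ-≤ z ; from-mono = +-monoʳ-≤ (- z)
    ; to∘from = \\-leftDividesˡ z ; from∘to = \\-leftDividesʳ z }

  -‿iso : OrderIsomorphism order (LatticeProperties.∧-∨-lattice order)
  -‿iso = record
    { to = -_ ; from = -_ ; to-mono = -‿antitone ; from-mono = -‿antitone
    ; to∘from = -‿involutive ; from∘to = -‿involutive }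

  +-distribˡ-⊓ : ∀ z x y → z + (x ⊓ y) ≡ (z + x) ⊓ (z + y)
  +-distribˡ-⊓ z = to-∧ (+-iso z)

  +-distribˡ-⊔ : ∀ z x y → z + (x ⊔ y) ≡ (z + x) ⊔ (z + y)
  +-distribˡ-⊔ z = to-∨ (+-iso z)

  -‿⊓ : ∀ x y → - (x ⊓ y) ≡ (- x) ⊔ (- y)
  -‿⊓ = to-∧ -‿iso

  -‿⊔ : ∀ x y → - (x ⊔ y) ≡ (- x) ⊓ (- y)
  -‿⊔ = to-∨ -‿iso

  private module ≤-R = ≤-Reasoning (Lattice.poset order)
  open import Algebra.Definitions (_≡_ {A = Carrier}) using (_DistributesOverʳ_)

  +-distribʳ-⊓ : ∀ z x y → (x ⊓ y) + z ≡ (x + z) ⊓ (y + z)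
  +-distribʳ-⊓ z x y = ≡.trans (comm _ z) (≡.trans (+-distribˡ-⊓ z x y) (cong₂ _⊓_ (comm z x) (comm z y)))

  x⊔y≡x+y-x⊓y : ∀ x y → x ⊔ y ≡ (x + y) + - (x ⊓ y)
  x⊔y≡x+y-x⊓y x y = sym (begin
    (x + y) + - (x ⊓ y)                  ≡⟨ cong ((x + y) +_) (-‿⊓ x y) ⟩
    (x + y) + ((- x) ⊔ (- y))            ≡⟨ +-distribˡ-⊔ (x + y) (- x) (- y) ⟩
    ((x + y) + - x) ⊔ ((x + y) + - y)    ≡⟨ cong₂ _⊔_ (≡.trans (cong (_+ - x) (comm x y)) (//-rightDividesʳ x y))
                                                      (//-rightDividesʳ y x) ⟩
    y ⊔ x                                ≡⟨ ∨-comm y x ⟩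
    x ⊔ y                                ∎)
    where open ≡.≡-Reasoning

  ⊔-distribʳ-⊓ : _⊔_ DistributesOverʳ _⊓_
  ⊔-distribʳ-⊓ z x y = ≤-antisym
    (∧-greatest (∨-monotonic (x∧y≤x x y) ≤-refl) (∨-monotonic (x∧y≤y x y) ≤-refl)) (begin
    (x ⊔ z) ⊓ (y ⊔ z)                    ≤⟨ ∧-monotonic (bound x (x∧y≤x x y)) (bound y (x∧y≤y x y)) ⟩
    ((x + z) + - m) ⊓ ((y + z) + - m)    ≡⟨ +-distribʳ-⊓ (- m) _ _ ⟨
    ((x + z) ⊓ (y + z)) + - m            ≡⟨ cong (_+ - m) (+-distribʳ-⊓ z x y) ⟨
    ((x ⊓ y) + z) + - m                  ≡⟨ x⊔y≡x+y-x⊓y (x ⊓ y) z ⟨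
    (x ⊓ y) ⊔ z                          ∎)
    where
    open ≤-R
    m : Carrier
    m = (x ⊓ y) ⊓ z
    bound : ∀ w → x ⊓ y ≤ w → w ⊔ z ≤ (w + z) + - m
    bound w x⊓y≤w = begin
      w ⊔ z                ≡⟨ x⊔y≡x+y-x⊓y w z ⟩
      (w + z) + - (w ⊓ z)  ≤⟨ +-monoʳ-≤ (w + z) (-‿antitone (∧-monotonic x⊓y≤w ≤-refl)) ⟩
      (w + z) + - m        ∎

  x≤x+y : ∀ {x y} → 0# ≤ y → x ≤ x + y
  x≤x+y {x} 0≤y = subst (_≤ x + _) (identityʳ x) (+-monoʳ-≤ x 0≤y)

  x≤y+x : ∀ {x y} → 0# ≤ y → x ≤ y + x
  x≤y+x {x} 0≤y = subst (_≤ _ + x) (identityˡ x) (+-monoˡ-≤ x 0≤y)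

  ·-monoʳ-≤ : ∀ {r x y} → 0ℝ ≤ℝ r → x ≤ y → r · x ≤ r · y
  ·-monoʳ-≤ {r} {x} {y} 0≤r x≤y = subst (λ w → r · w ≤ r · y) x≤y (·-compat r x y 0≤r)

  ·-zeroʳ : ∀ r → r · 0# ≡ 0#
  ·-zeroʳ r = identityˡ-unique _ _ (≡.trans (sym (·-distribˡ r 0# 0#)) (cong (r ·_) (identityˡ 0#)))

  ·-zeroˡ : ∀ x → 0ℝ · x ≡ 0#
  ·-zeroˡ x = identityˡ-unique _ _ (≡.trans (sym (·-distribʳ 0ℝ 0ℝ x)) (cong (_· x) (ℝ.+-identityˡ 0ℝ)))

  ·-neg : ∀ r x → r · (- x) ≡ - (r · x)
  ·-neg r x = inverseʳ-unique _ _
    (≡.trans (sym (·-distribˡ r x (- x))) (≡.trans (cong (r ·_) (inverseʳ x)) (·-zeroʳ r)))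

  ·-nonneg : ∀ {r x} → 0ℝ ≤ℝ r → 0# ≤ x → 0# ≤ r · x
  ·-nonneg {r} 0≤r 0≤x = subst (_≤ _) (·-zeroʳ r) (·-monoʳ-≤ 0≤r 0≤x)

  ·-monoˡ-≤ : ∀ {a b x} → a ≤ℝ b → 0# ≤ x → a · x ≤ b · x
  ·-monoˡ-≤ (inj₂ ≡.refl) 0≤x = ≤-refl
  ·-monoˡ-≤ {a} {b} {x} (inj₁ a<b) 0≤x = begin
    a · x                      ≤⟨ x≤x+y (·-nonneg (inj₁ (ℝ.x<y⇒0<y-x a<b)) 0≤x) ⟩
    a · x + (b +ℝ -ℝ a) · x    ≡⟨ ·-distribʳ a _ x ⟨
    (a +ℝ (b +ℝ -ℝ a)) · x     ≡⟨ cong (_· x) (ℝ.x+[y-x]≡y a b) ⟩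
    b · x                      ∎
    where open ≤-R

  ·-iso : ∀ {r} → 0ℝ <ℝ r → OrderIsomorphism order order
  ·-iso {r} 0<r = record
    { to = r ·_ ; from = r⁻¹ ·_
    ; to-mono = ·-monoʳ-≤ (inj₁ 0<r) ; from-mono = ·-monoʳ-≤ (inj₁ (ℝ.⁻¹-pos 0<r))
    ; to∘from = λ y → cancel (⁻¹-inverse r _) y
    ; from∘to = λ x → cancel (≡.trans (ℝ.*-comm r⁻¹ r) (⁻¹-inverse r _)) x }
    where
    r⁻¹ : ℝ
    r⁻¹ = (r ⁻¹ℝ) (ℝ.0<⇒≢0 0<r)
    cancel : ∀ {s t} → s *ℝ t ≡ 1ℝ → ∀ x → s · (t · x) ≡ x
    cancel {s} {t} st≡1 x = ≡.trans (sym (·-assoc s t x)) (≡.trans (cong (_· x) st≡1) (·-identity x))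

  ·-distrib-⊓ : ∀ {r} → 0ℝ ≤ℝ r → ∀ x y → r · (x ⊓ y) ≡ (r · x) ⊓ (r · y)
  ·-distrib-⊓ (inj₁ 0<r) = to-∧ (·-iso 0<r)
  ·-distrib-⊓ (inj₂ ≡.refl) x y =
    ≡.trans (·-zeroˡ _) (sym (≡.trans (cong₂ _⊓_ (·-zeroˡ x) (·-zeroˡ y)) (∧-idempotent 0#)))

  ·-distrib-⊔ : ∀ {r} → 0ℝ ≤ℝ r → ∀ x y → r · (x ⊔ y) ≡ (r · x) ⊔ (r · y)
  ·-distrib-⊔ (inj₁ 0<r) = to-∨ (·-iso 0<r)
  ·-distrib-⊔ (inj₂ ≡.refl) x y =
    ≡.trans (·-zeroˡ _) (sym (≡.trans (cong₂ _⊔_ (·-zeroˡ x) (·-zeroˡ y)) (∨-idempotent 0#)))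

  infix 30 _⁻

  _⁻ : Carrier → Carrier
  x ⁻ = (- x) ⊔ 0#

  ⁻-nonneg : ∀ x → 0# ≤ x ⁻
  ⁻-nonneg x = y≤x∨y (- x) 0#

  0≤⇒⁻≤0 : ∀ {x} → 0# ≤ x → x ⁻ ≤ 0#
  0≤⇒⁻≤0 0≤x = ∨-least (subst (_ ≤_) -0#≡0# (-‿antitone 0≤x)) ≤-refl

  ⁻≤0⇒0≤ : ∀ {x} → x ⁻ ≤ 0# → 0# ≤ x
  ⁻≤0⇒0≤ {x} x⁻≤0 = subst₂ _≤_ -0#≡0# (-‿involutive x) (-‿antitone (≤-trans (x≤x∨y (- x) 0#) x⁻≤0))

  ⁻-⊔ : ∀ x y → (x ⊔ y) ⁻ ≡ x ⁻ ⊓ y ⁻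
  ⁻-⊔ x y = ≡.trans (cong (_⊔ 0#) (-‿⊔ x y)) (⊔-distribʳ-⊓ 0# (- x) (- y))

  ⁻-+ : ∀ x y → (x + y) ⁻ ≤ x ⁻ + y ⁻
  ⁻-+ x y = ∨-least
    (subst (_≤ x ⁻ + y ⁻) (-‿+-comm x y) (+-mono-≤ (x≤x∨y (- x) 0#) (x≤x∨y (- y) 0#)))
    (subst (_≤ x ⁻ + y ⁻) (identityʳ 0#) (+-mono-≤ (⁻-nonneg x) (⁻-nonneg y)))

  ·-⁻ : ∀ {r} → 0ℝ ≤ℝ r → ∀ x → (r · x) ⁻ ≡ r · x ⁻
  ·-⁻ {r} 0≤r x = ≡.trans (cong₂ _⊔_ (sym (·-neg r x)) (sym (·-zeroʳ r))) (sym (·-distrib-⊔ 0≤r (- x) 0#))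

  ⊓-subadditive : ∀ {p q w} → 0# ≤ p → 0# ≤ q → 0# ≤ w → (p + q) ⊓ w ≤ (p ⊓ w) + (q ⊓ w)
  ⊓-subadditive {p} {q} {w} 0≤p 0≤q 0≤w = begin
    (p + q) ⊓ w                                  ≤⟨ ∧-greatest (∧-greatest (x∧y≤x _ _) (below (x≤y+x 0≤p)))
                                                               (∧-greatest (below (x≤x+y 0≤q)) (below (x≤x+y 0≤w))) ⟩
    ((p + q) ⊓ (p + w)) ⊓ ((w + q) ⊓ (w + w))    ≡⟨ cong₂ _⊓_ (+-distribˡ-⊓ p q w) (+-distribˡ-⊓ w q w) ⟨
    (p + (q ⊓ w)) ⊓ (w + (q ⊓ w))                ≡⟨ +-distribʳ-⊓ (q ⊓ w) p w ⟨
    (p ⊓ w) + (q ⊓ w)                            ∎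
    where
    open ≤-R
    below : ∀ {u} → w ≤ u → (p + q) ⊓ w ≤ u
    below w≤u = ≤-trans (x∧y≤y _ _) w≤u

  0≤⊔⇒⁻⊓⁻≤0 : ∀ {x g} → 0# ≤ x ⊔ g → x ⁻ ⊓ g ⁻ ≤ 0#
  0≤⊔⇒⁻⊓⁻≤0 {x} {g} 0≤x⊔g = subst (_≤ 0#) (⁻-⊔ x g) (0≤⇒⁻≤0 0≤x⊔g)

  ⁻⊓⁻≤0⇒0≤⊔ : ∀ {x g} → x ⁻ ⊓ g ⁻ ≤ 0# → 0# ≤ x ⊔ g
  ⁻⊓⁻≤0⇒0≤⊔ {x} {g} h = ⁻≤0⇒0≤ (subst (_≤ 0#) (sym (⁻-⊔ x g)) h)

  0≤⊔-+ : ∀ {x y g} → 0# ≤ x ⊔ g → 0# ≤ y ⊔ g → 0# ≤ (x + y) ⊔ g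
  0≤⊔-+ {x} {y} {g} 0≤x⊔g 0≤y⊔g = ⁻⊓⁻≤0⇒0≤⊔ (begin
    (x + y) ⁻ ⊓ g ⁻              ≤⟨ ∧-monotonic (⁻-+ x y) ≤-refl ⟩
    (x ⁻ + y ⁻) ⊓ g ⁻            ≤⟨ ⊓-subadditive (⁻-nonneg x) (⁻-nonneg y) (⁻-nonneg g) ⟩
    (x ⁻ ⊓ g ⁻) + (y ⁻ ⊓ g ⁻)    ≤⟨ +-mono-≤ (0≤⊔⇒⁻⊓⁻≤0 0≤x⊔g) (0≤⊔⇒⁻⊓⁻≤0 0≤y⊔g) ⟩
    0# + 0#                      ≡⟨ identityʳ 0# ⟩
    0#                           ∎)
    where open ≤-R

  0≤⊔-⊓ : ∀ {x y g} → 0# ≤ x ⊔ g → 0# ≤ y ⊔ g → 0# ≤ (x ⊓ y) ⊔ g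
  0≤⊔-⊓ {x} {y} {g} 0≤x⊔g 0≤y⊔g = subst (0# ≤_) (sym (⊔-distribʳ-⊓ g x y)) (∧-greatest 0≤x⊔g 0≤y⊔g)

  ⊓≤0-unscale : ∀ {r p q} → 0ℝ <ℝ r → 0# ≤ p → 0# ≤ q → (r · p) ⊓ q ≤ 0# → p ⊓ q ≤ 0#
  ⊓≤0-unscale {r} {p} {q} 0<r 0≤p 0≤q rp⊓q≤0 with ℝ.≤-total 1ℝ r
  ... | inj₁ 1≤r = ≤-trans (∧-monotonic p≤rp ≤-refl) rp⊓q≤0
    where
    p≤rp : p ≤ r · p
    p≤rp = subst (_≤ r · p) (·-identity p) (·-monoˡ-≤ 1≤r 0≤p)
  ... | inj₂ r≤1 = begin
    p ⊓ q              ≡⟨ from∘to (p ⊓ q) ⟨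
    from (r · (p ⊓ q)) ≤⟨ from-mono (≤-trans (≤-reflexive (·-distrib-⊓ (inj₁ 0<r) p q)) (∧-monotonic ≤-refl rq≤q)) ⟩
    from ((r · p) ⊓ q) ≤⟨ from-mono rp⊓q≤0 ⟩
    from 0#            ≡⟨ ·-zeroʳ _ ⟩
    0#                 ∎
    where
    open ≤-R
    open OrderIsomorphism (·-iso 0<r) using (from; from-mono; from∘to)
    rq≤q : r · q ≤ q
    rq≤q = subst (r · q ≤_) (·-identity q) (·-monoˡ-≤ r≤1 0≤q)

  0≤⊔-unscale : ∀ {r x g} → 0ℝ <ℝ r → 0# ≤ (r · x) ⊔ g → 0# ≤ x ⊔ g
  0≤⊔-unscale {r} {x} {g} 0<r 0≤rx⊔g = ⁻⊓⁻≤0⇒0≤⊔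
    (⊓≤0-unscale 0<r (⁻-nonneg x) (⁻-nonneg g) (subst (λ w → w ⊓ g ⁻ ≤ 0#) (·-⁻ (inj₁ 0<r) x) (0≤⊔⇒⁻⊓⁻≤0 0≤rx⊔g)))

  0≤⊔-split : ∀ {x y g} → 0# ≤ (x + y) ⊔ g → 0# ≤ (x ⊔ y) ⊔ g
  0≤⊔-split {x} {y} {g} 0≤x+y⊔g =
    subst (0# ≤_) (∨-idempotent m) (0≤⊔-unscale 0<2 (≤-trans 0≤x+y⊔g (∨-monotonic x+y≤2m (y≤x∨y _ g))))
    where
    open ≤-R
    m : Carrier
    m = (x ⊔ y) ⊔ g
    0<2 : 0ℝ <ℝ 1ℝ +ℝ 1ℝ
    0<2 = ℝ.+-pos ℝ.0<1 (inj₁ ℝ.0<1)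
    x+y≤2m : x + y ≤ (1ℝ +ℝ 1ℝ) · m
    x+y≤2m = begin
      x + y                   ≤⟨ +-mono-≤ (≤-trans (x≤x∨y x y) (x≤x∨y _ g)) (≤-trans (y≤x∨y x y) (x≤x∨y _ g)) ⟩
      m + m                   ≡⟨ cong₂ _+_ (·-identity m) (·-identity m) ⟨
      1ℝ · m + 1ℝ · m         ≡⟨ ·-distribʳ 1ℝ 1ℝ m ⟨
      (1ℝ +ℝ 1ℝ) · m          ∎

module Soundness (F : RealField) (V : RieszSpace F) (ρ : ℕ → RieszSpace.Carrier V) where

  open RealField F using () renaming (0# to 0ℝ; _≤_ to _≤ℝ_)
  private module ℝ = OrderedFieldProperties F
  open RieszSpace V
  open RieszSpaceProperties F V
  open Syntax F
  open Interp V ρ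
  open CommutativeSemigroupProperties ⊔-commutativeSemigroup using (x∙yz≈y∙xz)
  private module ≤-R = ≤-Reasoning (Lattice.poset order)

  Σ⁺-nonneg : ∀ rs → 0ℝ ≤ℝ Σ⁺ rs
  Σ⁺-nonneg []               = inj₂ ≡.refl
  Σ⁺-nonneg ((r , 0<r) ∷ rs) = inj₁ (ℝ.+-pos 0<r (Σ⁺-nonneg rs))

  ⟦neg⟧ : ∀ A → ⟦ neg A ⟧ₜ ≡ - ⟦ A ⟧ₜ
  ⟦neg⟧ (var x)  = ≡.refl
  ⟦neg⟧ (nvar x) = sym (-‿involutive _)
  ⟦neg⟧ zero     = sym -0#≡0#
  ⟦neg⟧ (A ⊕ B)  = ≡.trans (cong₂ _+_ (⟦neg⟧ A) (⟦neg⟧ B)) (-‿+-comm _ _)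
  ⟦neg⟧ (r ⊛ A)  = ≡.trans (cong (proj₁ r ·_) (⟦neg⟧ A)) (·-neg _ _)
  ⟦neg⟧ (A ⊔ₜ B) = ≡.trans (cong₂ _⊓_ (⟦neg⟧ A) (⟦neg⟧ B)) (sym (-‿⊔ _ _))
  ⟦neg⟧ (A ⊓ₜ B) = ≡.trans (cong₂ _⊔_ (⟦neg⟧ A) (⟦neg⟧ B)) (sym (-‿⊓ _ _))

  ⟦++⟧ₛ : ∀ Γ Δ → ⟦ Γ ++ Δ ⟧ₛ ≡ ⟦ Γ ⟧ₛ + ⟦ Δ ⟧ₛ
  ⟦++⟧ₛ []            Δ = sym (identityˡ _)
  ⟦++⟧ₛ ((r , A) ∷ Γ) Δ = ≡.trans (cong (proj₁ r · ⟦ A ⟧ₜ +_) (⟦++⟧ₛ Γ Δ)) (sym (assoc _ _ _))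

  ⟦∙ₗ⟧ₛ : ∀ rs A → ⟦ rs ∙ₗ A ⟧ₛ ≡ Σ⁺ rs · ⟦ A ⟧ₜ
  ⟦∙ₗ⟧ₛ []       A = sym (·-zeroˡ _)
  ⟦∙ₗ⟧ₛ (r ∷ rs) A = ≡.trans (cong (proj₁ r · ⟦ A ⟧ₜ +_) (⟦∙ₗ⟧ₛ rs A)) (sym (·-distribʳ _ _ _))

  ⟦scaleS⟧ₛ : ∀ s Γ → ⟦ scaleS s Γ ⟧ₛ ≡ proj₁ s · ⟦ Γ ⟧ₛ
  ⟦scaleS⟧ₛ s []            = sym (·-zeroʳ _)
  ⟦scaleS⟧ₛ s ((r , A) ∷ Γ) =
    ≡.trans (cong₂ _+_ (·-assoc (proj₁ s) (proj₁ r) ⟦ A ⟧ₜ) (⟦scaleS⟧ₛ s Γ)) (sym (·-distribˡ _ _ _))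

  ⟦scaleV⟧ₛ : ∀ s rs A → ⟦ scaleV s rs ∙ₗ A ⟧ₛ ≡ ⟦ rs ∙ₗ (s ⊛ A) ⟧ₛ
  ⟦scaleV⟧ₛ s []       A = ≡.refl
  ⟦scaleV⟧ₛ s (r ∷ rs) A =
    cong₂ _+_ (≡.trans (cong (_· ⟦ A ⟧ₜ) (ℝ.*-comm (proj₁ s) (proj₁ r))) (·-assoc _ _ _)) (⟦scaleV⟧ₛ s rs A)

  ⟦⟧ₛ-↭ : ∀ {Γ Δ} → Γ ↭ Δ → ⟦ Γ ⟧ₛ ≡ ⟦ Δ ⟧ₛ
  ⟦⟧ₛ-↭ {Γ} {Δ} Γ↭Δ =
    ≡.trans (as-foldr Γ) (≡.trans (foldr-↭ +-commutativeSemigroup weigh 0# Γ↭Δ) (sym (as-foldr Δ)))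
    where
    weigh : WTerm → Carrier
    weigh (r , A) = proj₁ r · ⟦ A ⟧ₜ
    as-foldr : ∀ Γ → ⟦ Γ ⟧ₛ ≡ foldr (λ a → weigh a +_) 0# Γ
    as-foldr []      = ≡.refl
    as-foldr (a ∷ Γ) = cong (weigh a +_) (as-foldr Γ)

  ⟦,∙ₗ⟧ₛ : ∀ Γ rs A → ⟦ Γ ++ (rs ∙ₗ A) ⟧ₛ ≡ ⟦ Γ ⟧ₛ + Σ⁺ rs · ⟦ A ⟧ₜ
  ⟦,∙ₗ⟧ₛ Γ rs A = ≡.trans (⟦++⟧ₛ Γ _) (cong (⟦ Γ ⟧ₛ +_) (⟦∙ₗ⟧ₛ rs A))

  ⟦,∙ₗ,∙ₗ⟧ₛ : ∀ Γ rs A ss B → ⟦ Γ ++ (rs ∙ₗ A) ++ (ss ∙ₗ B) ⟧ₛ ≡ ⟦ Γ ⟧ₛ + (Σ⁺ rs · ⟦ A ⟧ₜ + Σ⁺ ss · ⟦ B ⟧ₜ)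
  ⟦,∙ₗ,∙ₗ⟧ₛ Γ rs A ss B =
    ≡.trans (⟦++⟧ₛ Γ _) (cong (⟦ Γ ⟧ₛ +_) (≡.trans (⟦++⟧ₛ (rs ∙ₗ A) _) (cong₂ _+_ (⟦∙ₗ⟧ₛ rs A) (⟦∙ₗ⟧ₛ ss B))))

  cancel-sound : ∀ Γ rs A ss B → Σ⁺ rs ≡ Σ⁺ ss → ⟦ B ⟧ₜ ≡ - ⟦ A ⟧ₜ →
                 ⟦ Γ ++ (rs ∙ₗ A) ++ (ss ∙ₗ B) ⟧ₛ ≡ ⟦ Γ ⟧ₛ
  cancel-sound Γ rs A ss B Σrs≡Σss b≡-a = begin
    ⟦ Γ ++ (rs ∙ₗ A) ++ (ss ∙ₗ B) ⟧ₛ               ≡⟨ ⟦,∙ₗ,∙ₗ⟧ₛ Γ rs A ss B ⟩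
    ⟦ Γ ⟧ₛ + (Σ⁺ rs · ⟦ A ⟧ₜ + Σ⁺ ss · ⟦ B ⟧ₜ)      ≡⟨ cong (λ t → ⟦ Γ ⟧ₛ + (Σ⁺ rs · ⟦ A ⟧ₜ + t)) ss·b≡-[rs·a] ⟩
    ⟦ Γ ⟧ₛ + (Σ⁺ rs · ⟦ A ⟧ₜ + - (Σ⁺ rs · ⟦ A ⟧ₜ)) ≡⟨ cong (⟦ Γ ⟧ₛ +_) (inverseʳ _) ⟩
    ⟦ Γ ⟧ₛ + 0#                                    ≡⟨ identityʳ _ ⟩
    ⟦ Γ ⟧ₛ                                         ∎
    where
    open ≡.≡-Reasoning
    ss·b≡-[rs·a] : Σ⁺ ss · ⟦ B ⟧ₜ ≡ - (Σ⁺ rs · ⟦ A ⟧ₜ)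
    ss·b≡-[rs·a] = ≡.trans (cong₂ _·_ (sym Σrs≡Σss) b≡-a) (·-neg _ _)

  zero-sound : ∀ Γ rs → ⟦ Γ ++ (rs ∙ₗ zero) ⟧ₛ ≡ ⟦ Γ ⟧ₛ
  zero-sound Γ rs = ≡.trans (⟦,∙ₗ⟧ₛ Γ rs zero) (≡.trans (cong (⟦ Γ ⟧ₛ +_) (·-zeroʳ _)) (identityʳ _))

  plus-sound : ∀ Γ rs A B → ⟦ Γ ++ (rs ∙ₗ A) ++ (rs ∙ₗ B) ⟧ₛ ≡ ⟦ Γ ++ (rs ∙ₗ (A ⊕ B)) ⟧ₛ
  plus-sound Γ rs A B = ≡.trans (⟦,∙ₗ,∙ₗ⟧ₛ Γ rs A rs B)
    (sym (≡.trans (⟦,∙ₗ⟧ₛ Γ rs (A ⊕ B)) (cong (⟦ Γ ⟧ₛ +_) (·-distribˡ _ _ _))))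

  times-sound : ∀ Γ rs s A → ⟦ Γ ++ (scaleV s rs ∙ₗ A) ⟧ₛ ≡ ⟦ Γ ++ (rs ∙ₗ (s ⊛ A)) ⟧ₛ
  times-sound Γ rs s A = ≡.trans (⟦++⟧ₛ Γ _) (≡.trans (cong (⟦ Γ ⟧ₛ +_) (⟦scaleV⟧ₛ s rs A)) (sym (⟦++⟧ₛ Γ _)))

  join-sound : ∀ Γ rs A B → ⟦ Γ ++ (rs ∙ₗ A) ⟧ₛ ⊔ ⟦ Γ ++ (rs ∙ₗ B) ⟧ₛ ≡ ⟦ Γ ++ (rs ∙ₗ (A ⊔ₜ B)) ⟧ₛ
  join-sound Γ rs A B = begin
    ⟦ Γ ++ (rs ∙ₗ A) ⟧ₛ ⊔ ⟦ Γ ++ (rs ∙ₗ B) ⟧ₛ          ≡⟨ cong₂ _⊔_ (⟦,∙ₗ⟧ₛ Γ rs A) (⟦,∙ₗ⟧ₛ Γ rs B) ⟩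
    (⟦ Γ ⟧ₛ + Σ⁺ rs · ⟦ A ⟧ₜ) ⊔ (⟦ Γ ⟧ₛ + Σ⁺ rs · ⟦ B ⟧ₜ) ≡⟨ +-distribˡ-⊔ _ _ _ ⟨
    ⟦ Γ ⟧ₛ + ((Σ⁺ rs · ⟦ A ⟧ₜ) ⊔ (Σ⁺ rs · ⟦ B ⟧ₜ))      ≡⟨ cong (⟦ Γ ⟧ₛ +_) (·-distrib-⊔ (Σ⁺-nonneg rs) _ _) ⟨
    ⟦ Γ ⟧ₛ + Σ⁺ rs · (⟦ A ⟧ₜ ⊔ ⟦ B ⟧ₜ)                  ≡⟨ ⟦,∙ₗ⟧ₛ Γ rs (A ⊔ₜ B) ⟨
    ⟦ Γ ++ (rs ∙ₗ (A ⊔ₜ B)) ⟧ₛ                          ∎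
    where open ≡.≡-Reasoning

  meet-sound : ∀ Γ rs A B → ⟦ Γ ++ (rs ∙ₗ A) ⟧ₛ ⊓ ⟦ Γ ++ (rs ∙ₗ B) ⟧ₛ ≡ ⟦ Γ ++ (rs ∙ₗ (A ⊓ₜ B)) ⟧ₛ
  meet-sound Γ rs A B = begin
    ⟦ Γ ++ (rs ∙ₗ A) ⟧ₛ ⊓ ⟦ Γ ++ (rs ∙ₗ B) ⟧ₛ          ≡⟨ cong₂ _⊓_ (⟦,∙ₗ⟧ₛ Γ rs A) (⟦,∙ₗ⟧ₛ Γ rs B) ⟩
    (⟦ Γ ⟧ₛ + Σ⁺ rs · ⟦ A ⟧ₜ) ⊓ (⟦ Γ ⟧ₛ + Σ⁺ rs · ⟦ B ⟧ₜ) ≡⟨ +-distribˡ-⊓ _ _ _ ⟨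
    ⟦ Γ ⟧ₛ + ((Σ⁺ rs · ⟦ A ⟧ₜ) ⊓ (Σ⁺ rs · ⟦ B ⟧ₜ))      ≡⟨ cong (⟦ Γ ⟧ₛ +_) (·-distrib-⊓ (Σ⁺-nonneg rs) _ _) ⟨
    ⟦ Γ ⟧ₛ + Σ⁺ rs · (⟦ A ⟧ₜ ⊓ ⟦ B ⟧ₜ)                  ≡⟨ ⟦,∙ₗ⟧ₛ Γ rs (A ⊓ₜ B) ⟨
    ⟦ Γ ++ (rs ∙ₗ (A ⊓ₜ B)) ⟧ₛ                          ∎
    where open ≡.≡-Reasoning

  infixl 5 _⊔ᴴ_

  _⊔ᴴ_ : Carrier → List Sequent → Carrier
  x ⊔ᴴ []      = x
  x ⊔ᴴ (Δ ∷ G) = x ⊔ (⟦ Δ ⟧ₛ ⊔ᴴ G)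

  ⟦∣⟧ₕ≡⊔ᴴ : ∀ Γ G → ⟦ Γ ∣ G ⟧ₕ ≡ ⟦ Γ ⟧ₛ ⊔ᴴ G
  ⟦∣⟧ₕ≡⊔ᴴ Γ []      = ≡.refl
  ⟦∣⟧ₕ≡⊔ᴴ Γ (Δ ∷ G) = cong (⟦ Γ ⟧ₛ ⊔_) (⟦∣⟧ₕ≡⊔ᴴ Δ G)

  ⊔ᴴ-∷ : ∀ x Δ G → x ⊔ (⟦ Δ ⟧ₛ ⊔ᴴ G) ≡ (x ⊔ ⟦ Δ ⟧ₛ) ⊔ᴴ G
  ⊔ᴴ-∷ x Δ []      = ≡.refl
  ⊔ᴴ-∷ x Δ (Θ ∷ G) = sym (∨-assoc x ⟦ Δ ⟧ₛ _)

  ⊔ᴴ-lift : ∀ {x y} → (∀ {g} → 0# ≤ x ⊔ g → 0# ≤ y ⊔ g) → ∀ G → 0# ≤ x ⊔ᴴ G → 0# ≤ y ⊔ᴴ G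
  ⊔ᴴ-lift {x} {y} step []      0≤x = subst (0# ≤_) (∨-idempotent y) (step (≤-trans 0≤x (x≤x∨y x y)))
  ⊔ᴴ-lift         step (Δ ∷ G)     = step

  ⊔ᴴ-lift₂ : ∀ {x y z} → (∀ {g} → 0# ≤ x ⊔ g → 0# ≤ y ⊔ g → 0# ≤ z ⊔ g) →
             ∀ G → 0# ≤ x ⊔ᴴ G → 0# ≤ y ⊔ᴴ G → 0# ≤ z ⊔ᴴ G
  ⊔ᴴ-lift₂ {x} {y} {z} step [] 0≤x 0≤y =
    subst (0# ≤_) (∨-idempotent z) (step (≤-trans 0≤x (x≤x∨y x z)) (≤-trans 0≤y (x≤x∨y y z)))
  ⊔ᴴ-lift₂ step (Δ ∷ G) = step

  ⊔ᴴ-cong : ∀ {x y} → x ≡ y → ∀ G → 0# ≤ x ⊔ᴴ G → 0# ≤ y ⊔ᴴ G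
  ⊔ᴴ-cong x≡y G = subst (λ x → 0# ≤ x ⊔ᴴ G) x≡y

  ⊔ᴴ-↭ : ∀ {Γ G Δ H} → Γ ∷ G ↭ Δ ∷ H → ⟦ Γ ⟧ₛ ⊔ᴴ G ≤ ⟦ Δ ⟧ₛ ⊔ᴴ H
  ⊔ᴴ-↭ {Γ} {G} {Δ} {H} p = begin
    ⟦ Γ ⟧ₛ ⊔ᴴ G             ≤⟨ y≤x∨y d _ ⟩
    d ⊔ (⟦ Γ ⟧ₛ ⊔ᴴ G)       ≡⟨ ⋁-∷ Γ G ⟩
    ⋁ (Γ ∷ G)               ≡⟨ foldr-↭ ⊔-commutativeSemigroup ⟦_⟧ₛ d p ⟩
    ⋁ (Δ ∷ H)               ≡⟨ ⋁-∷ Δ H ⟨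
    d ⊔ d                   ≡⟨ ∨-idempotent d ⟩
    d                       ∎
    where
    open ≤-R
    -- ⊔ has no unit, so the folds are seeded with the right-hand side itself.
    d : Carrier
    d = ⟦ Δ ⟧ₛ ⊔ᴴ H
    ⋁ : List Sequent → Carrier
    ⋁ = foldr (λ Θ → ⟦ Θ ⟧ₛ ⊔_) d
    ⋁-∷ : ∀ Θ K → d ⊔ (⟦ Θ ⟧ₛ ⊔ᴴ K) ≡ ⋁ (Θ ∷ K)
    ⋁-∷ Θ []      = ∨-comm d ⟦ Θ ⟧ₛ
    ⋁-∷ Θ (Ψ ∷ K) = ≡.trans (x∙yz≈y∙xz d ⟦ Θ ⟧ₛ _) (cong (⟦ Θ ⟧ₛ ⊔_) (⋁-∷ Ψ K))

  Valid : List Sequent → Set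
  Valid []      = ⊥
  Valid (Γ ∷ G) = 0# ≤ ⟦ Γ ⟧ₛ ⊔ᴴ G

  Valid-↭ : ∀ {G H} → G ↭ H → Valid G → Valid H
  Valid-↭ {Γ ∷ G} {Δ ∷ H} p valid = ≤-trans valid (⊔ᴴ-↭ p)
  Valid-↭ {Γ ∷ G} {[]}    p       = ⊥-elim (¬x∷xs↭[] p)

  Valid-weaken : ∀ Γ {G} → Valid G → Valid (Γ ∷ G)
  Valid-weaken Γ {Δ ∷ G} valid = ≤-trans valid (y≤x∨y _ _)

  sound : ∀ {G} → HR G → Valid G
  sound INIT                           = ≤-refl
  sound (ex-H G↭H ⊢G)                  = Valid-↭ G↭H (sound ⊢G)
  sound (ex-S {G} Γ↭Δ ⊢Γ)              = ⊔ᴴ-cong (⟦⟧ₛ-↭ Γ↭Δ) G (sound ⊢Γ)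
  sound (W {Γ = Γ} ⊢G)                 = Valid-weaken Γ (sound ⊢G)
  sound (C {G} {Γ} ⊢ΓΓ)                =
    ⊔ᴴ-cong (∨-idempotent _) G (subst (0# ≤_) (⊔ᴴ-∷ ⟦ Γ ⟧ₛ Γ G) (sound ⊢ΓΓ))
  sound (S {G} {Γ₁} {Γ₂} ⊢Γ₁Γ₂)        =
    subst (0# ≤_) (sym (⊔ᴴ-∷ ⟦ Γ₁ ⟧ₛ Γ₂ G)) (⊔ᴴ-lift 0≤⊔-split G (⊔ᴴ-cong (⟦++⟧ₛ Γ₁ Γ₂) G (sound ⊢Γ₁Γ₂)))
  sound (M {G} {Γ₁} {Γ₂} ⊢Γ₁ ⊢Γ₂)      =
    ⊔ᴴ-cong (sym (⟦++⟧ₛ Γ₁ Γ₂)) G (⊔ᴴ-lift₂ 0≤⊔-+ G (sound ⊢Γ₁) (sound ⊢Γ₂))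
  sound (T {G} {Γ} r ⊢rΓ)              =
    ⊔ᴴ-lift (0≤⊔-unscale (proj₂ r)) G (⊔ᴴ-cong (⟦scaleS⟧ₛ r Γ) G (sound ⊢rΓ))
  sound (ID {G} {Γ} rs ss x Σrs≡Σss ⊢Γ) =
    ⊔ᴴ-cong (sym (cancel-sound Γ rs (var x) ss (nvar x) Σrs≡Σss ≡.refl)) G (sound ⊢Γ)
  sound (Z {G} {Γ} rs ⊢Γ)              = ⊔ᴴ-cong (sym (zero-sound Γ rs)) G (sound ⊢Γ)
  sound (PLUS {G} {Γ} rs A B ⊢)        = ⊔ᴴ-cong (plus-sound Γ rs A B) G (sound ⊢)
  sound (TIMES {G} {Γ} rs s A ⊢)       = ⊔ᴴ-cong (times-sound Γ rs s A) G (sound ⊢)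
  sound (JOIN {G} {Γ} rs A B ⊢)        =
    ⊔ᴴ-cong (join-sound Γ rs A B) G (subst (0# ≤_) (⊔ᴴ-∷ _ (Γ ++ (rs ∙ₗ B)) G) (sound ⊢))
  sound (MEET {G} {Γ} rs A B ⊢A ⊢B)    =
    ⊔ᴴ-cong (meet-sound Γ rs A B) G (⊔ᴴ-lift₂ 0≤⊔-⊓ G (sound ⊢A) (sound ⊢B))
  sound (CAN {G} {Γ} rs ss A Σrs≡Σss ⊢) =
    ⊔ᴴ-cong (cancel-sound Γ ss A rs (neg A) (sym Σrs≡Σss) (⟦neg⟧ A)) G (sound ⊢)

theorem3p9 : (F : RealField) (V : RieszSpace F) (ρ : ℕ → RieszSpace.Carrier V)
    (Γ : Syntax.Sequent F) (G : List (Syntax.Sequent F)) →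
    Syntax.HR F (Γ ∷ G) →
    RieszSpace._≤_ V (RieszSpace.0# V) (Syntax.Interp.⟦_∣_⟧ₕ F V ρ Γ G)
theorem3p9 F V ρ Γ G ⊢ΓG = subst (0# ≤_) (sym (⟦∣⟧ₕ≡⊔ᴴ Γ G)) (sound ⊢ΓG)
  where
  open RieszSpace V using (0#; _≤_)
  open Soundness F V ρ using (sound; ⟦∣⟧ₕ≡⊔ᴴ)
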